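{- For every integer $n\ge2$, $$\sum_{k=2}^n S(n,k)(k-2)!(-1)^k = n-1.$$
   Context: $S(n,k)$ are the Stirling numbers of the second kind. -}

module Defs where

open import Data.Nat using (ℕ; zero; suc; _+_; _*_; _∸_)
open import Data.Integer using (ℤ; +_; -_)
import Data.Integer as ℤ

S : ℕ → ℕ → ℕ
S zero    zero    = 1
S zero    (suc k) = 0
S (suc n) zero    = 0
S (suc n) (suc k) = suc k * S n (suc k) + S n k

sgn : ℕ → ℤ
sgn zero    = + 1
sgn (suc k) = - sgn k

-- Σ_{k=a}^{b} f k over ℤ, implemented as Σ_{j<b+1-a} f (a + j)
-- (empty sum = 0 when b < a)
sumRange : ℕ → (ℕ → ℤ) → ℤ
sumRange zero    f = + 0
sumRange (suc m) f = sumRange m f ℤ.+ f m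

sumFromTo : ℕ → ℕ → (ℕ → ℤ) → ℤ
sumFromTo a b f = sumRange (suc b ∸ a) (λ j → f (a + j))

-- Put T(n) = Σ_{j<n-1} S(n,j+2) j! (-1)^j. Weighting the recurrence
-- S(n+1,j+2) = (j+2) S(n,j+2) + S(n,j+1) by j! (-1)^j and splitting
-- (j+2) j! = j! + (j+1)! shows that the j-th summand for n+1 is the j-th
-- summand for n plus a telescoping difference E(n,j) - E(n,j+1), where
-- E(n,j) = S(n,j+1) j! (-1)^j. Summing, T(n+1) = T(n) + E(n,0) - E(n,n)
-- = T(n) + 1, since S(n,1) = 1 and S(n,n+1) = 0.
module Submission where

open import Defs
import Data.Nat as ℕ
open import Data.Nat using (ℕ; _≤_; _<_; _∸_; zero; suc; s≤s; z≤n)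
open import Data.Nat using (_!)
open import Data.Integer using (ℤ; +_; _+_; _-_; -_; _*_)
import Data.Integer as ℤ
import Data.Integer.Properties as ℤ
import Data.Nat.Properties as ℕ
import Data.Nat.Tactic.RingSolver as ℕ-Solver
import Data.Integer.Tactic.RingSolver as ℤ-Solver
open import Relation.Binary.PropositionalEquality
open ≡-Reasoning

sumRange-cong : ∀ m {f g : ℕ → ℤ} → (∀ j → f j ≡ g j) → sumRange m f ≡ sumRange m g
sumRange-cong zero    f≗g = refl
sumRange-cong (suc m) f≗g = cong₂ _+_ (sumRange-cong m f≗g) (f≗g m)

sumRange-+ : ∀ m (f g : ℕ → ℤ) →
  sumRange m (λ j → f j + g j) ≡ sumRange m f + sumRange m g
sumRange-+ zero    f g = refl
sumRange-+ (suc m) f g = begin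
  sumRange m (λ j → f j + g j) + (f m + g m)     ≡⟨ cong (_+ (f m + g m)) (sumRange-+ m f g) ⟩
  sumRange m f + sumRange m g + (f m + g m)      ≡⟨ interchange (sumRange m f) (sumRange m g) (f m) (g m) ⟩
  sumRange m f + f m + (sumRange m g + g m)      ∎
  where
  interchange : ∀ a b c d → a + b + (c + d) ≡ a + c + (b + d)
  interchange = ℤ-Solver.solve-∀

sumRange-telescope : ∀ m (f : ℕ → ℤ) → sumRange m (λ j → f j - f (suc j)) ≡ f 0 - f m
sumRange-telescope zero    f = sym (ℤ.+-inverseʳ (f 0))
sumRange-telescope (suc m) f = begin
  sumRange m (λ j → f j - f (suc j)) + (f m - f (suc m)) ≡⟨ cong (_+ (f m - f (suc m))) (sumRange-telescope m f) ⟩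
  f 0 - f m + (f m - f (suc m))                         ≡⟨ cancel (f 0) (f m) (f (suc m)) ⟩
  f 0 - f (suc m)                                       ∎
  where
  cancel : ∀ a b c → a - b + (b - c) ≡ a - c
  cancel = ℤ-Solver.solve-∀

<⇒S≡0 : ∀ {n k} → n < k → S n k ≡ 0
<⇒S≡0 {zero}  {suc k} _       = refl
<⇒S≡0 {suc n} {suc k} (s≤s p)
  rewrite <⇒S≡0 (ℕ.m<n⇒m<1+n p) | <⇒S≡0 p | ℕ.*-zeroʳ k = refl

S-suc-one : ∀ n → S (suc n) 1 ≡ 1
S-suc-one zero    = refl
S-suc-one (suc n) rewrite S-suc-one n = refl

S-recurrence-weighted : ∀ n j →
  S (suc n) (2 ℕ.+ j) ℕ.* j ! ≡
  S n (2 ℕ.+ j) ℕ.* j ! ℕ.+ S n (2 ℕ.+ j) ℕ.* suc j ! ℕ.+ S n (1 ℕ.+ j) ℕ.* j !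
S-recurrence-weighted n j = split j (S n (2 ℕ.+ j)) (S n (1 ℕ.+ j)) (j !)
  where
  split : ∀ j s₂ s₁ f →
    ((2 ℕ.+ j) ℕ.* s₂ ℕ.+ s₁) ℕ.* f ≡ s₂ ℕ.* f ℕ.+ s₂ ℕ.* ((1 ℕ.+ j) ℕ.* f) ℕ.+ s₁ ℕ.* f
  split = ℕ-Solver.solve-∀

term : ℕ → ℕ → ℤ
term n j = + (S n (2 ℕ.+ j) ℕ.* j !) * sgn j

boundary : ℕ → ℕ → ℤ
boundary n j = + (S n (1 ℕ.+ j) ℕ.* j !) * sgn j

term-suc : ∀ n j → term (suc n) j ≡ term n j + (boundary n j - boundary n (suc j))
term-suc n j = begin
  + (S (suc n) (2 ℕ.+ j) ℕ.* j !) * σ ≡⟨ cong (λ w → + w * σ) (S-recurrence-weighted n j) ⟩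
  + (x ℕ.+ y ℕ.+ z) * σ               ≡⟨ cong (_* σ) (trans (ℤ.pos-+ (x ℕ.+ y) z) (cong (_+ + z) (ℤ.pos-+ x y))) ⟩
  (+ x + + y + + z) * σ               ≡⟨ regroup (+ x) (+ y) (+ z) σ ⟩
  + x * σ + (+ z * σ - + y * - σ)     ∎
  where
  σ = sgn j
  x = S n (2 ℕ.+ j) ℕ.* j !
  y = S n (2 ℕ.+ j) ℕ.* suc j !
  z = S n (1 ℕ.+ j) ℕ.* j !
  regroup : ∀ a b c s → (a + b + c) * s ≡ a * s + (c * s - b * - s)
  regroup = ℤ-Solver.solve-∀

term-vanishes : ∀ {n j} → n < 2 ℕ.+ j → term n j ≡ + 0
term-vanishes p rewrite <⇒S≡0 p = refl

boundary-vanishes : ∀ {n j} → n < 1 ℕ.+ j → boundary n j ≡ + 0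
boundary-vanishes p rewrite <⇒S≡0 p = refl

boundary-zero : ∀ n → boundary (suc n) 0 ≡ + 1
boundary-zero n rewrite S-suc-one n = refl

stirlingSum : ℕ → ℕ → ℤ
stirlingSum n m = sumRange m (term n)

stirlingSum-suc : ∀ n m → stirlingSum (suc n) m ≡ stirlingSum n m + (boundary n 0 - boundary n m)
stirlingSum-suc n m = begin
  sumRange m (term (suc n))                                         ≡⟨ sumRange-cong m (term-suc n) ⟩
  sumRange m (λ j → term n j + (boundary n j - boundary n (suc j))) ≡⟨ sumRange-+ m (term n) _ ⟩
  stirlingSum n m + sumRange m (λ j → boundary n j - boundary n (suc j))
                                                                    ≡⟨ cong (λ t → stirlingSum n m + t) (sumRange-telescope m (boundary n)) ⟩
  stirlingSum n m + (boundary n 0 - boundary n m)                   ∎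

stirlingSum-diagonal : ∀ n → stirlingSum (suc n) n ≡ + n
stirlingSum-diagonal zero    = refl
stirlingSum-diagonal (suc n) = begin
  stirlingSum (2 ℕ.+ n) (suc n)
    ≡⟨ stirlingSum-suc (suc n) (suc n) ⟩
  stirlingSum (suc n) n + term (suc n) n + (boundary (suc n) 0 - boundary (suc n) (suc n))
    ≡⟨ cong₂ _+_ (cong₂ _+_ (stirlingSum-diagonal n) (term-vanishes (ℕ.n<1+n (suc n))))
                 (cong₂ _-_ (boundary-zero n) (boundary-vanishes (ℕ.n<1+n (suc n)))) ⟩
  + n + + 0 + + 1
    ≡⟨ cong (_+ + 1) (ℤ.+-identityʳ (+ n)) ⟩
  + n + + 1
    ≡⟨ ℤ.+-comm (+ n) (+ 1) ⟩
  + suc n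
    ∎

corollary14 : (n : ℕ) → 2 ≤ n →
    sumFromTo 2 n (λ k → (+ (S n k ℕ.* ((k ∸ 2) !))) ℤ.* sgn k) ≡ + (n ∸ 1)
corollary14 (suc (suc m)) (s≤s (s≤s z≤n)) = begin
  sumRange (suc m) (λ j → + (S (2 ℕ.+ m) (2 ℕ.+ j) ℕ.* j !) * - - sgn j)
    ≡⟨ sumRange-cong (suc m) (λ j → cong (+ (S (2 ℕ.+ m) (2 ℕ.+ j) ℕ.* j !) *_) (ℤ.neg-involutive (sgn j))) ⟩
  stirlingSum (2 ℕ.+ m) (suc m)
    ≡⟨ stirlingSum-diagonal (suc m) ⟩
  + suc m
    ∎
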